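{- If $G$ is a finite simple graph with minimum degree $\delta$, then $\mathrm{Hun}(G)\ge\delta$.
   Context: Hunter strategy on $G$: finite sequence $H=(H_1,\dots,H_m)$ of multisets of vertices; with $N(S)$ the set of vertices adjacent to some vertex of $S$, set $R_H(0)=V(G)$, $R_H(i)=N(R_H(i-1)\setminus H_i)$; $H$ is winning if $R_H(i)=\emptyset$ for some $i$. $\mathrm{Hun}(G)$ is the minimum over winning strategies of $\max_i|H_i|$ (multiplicities counted). -}

module Defs where

open import Data.Nat using (ℕ; _+_; _⊔_; _≤_)
open import Data.Bool using (Bool; true; false; _∧_; not; if_then_else_)
open import Data.Fin using (Fin; _≟_)
open import Data.List using (List; []; _∷_; map; foldr; length; allFin)
open import Data.Nat.ListAction using (sum)
open import Data.Bool.ListAction using (any)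
open import Data.List.Relation.Unary.Any using (Any)
open import Data.Product using (∃; _×_)
open import Relation.Nullary.Decidable using (⌊_⌋)
open import Relation.Binary.PropositionalEquality using (_≡_)

record Graph (n : ℕ) : Set where
  field
    adj   : Fin n → Fin n → Bool
    sym   : ∀ u v → adj u v ≡ adj v u
    irrefl : ∀ v → adj v v ≡ false
open Graph public

degree : ∀ {n} → Graph n → Fin n → ℕ
degree {n} G v = sum (map (λ w → if adj G v w then 1 else 0) (allFin n))

IsMinDegree : ∀ {n} → Graph n → ℕ → Set
IsMinDegree G δ = (∀ v → δ ≤ degree G v) × ∃ (λ v → degree G v ≡ δ)

VSet : ℕ → Set
VSet n = Fin n → Bool

-- a multiset of vertices is a list; its size (with multiplicity) is its length
Multiset : ℕ → Set
Multiset n = List (Fin n)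

Strategy : ℕ → Set
Strategy n = List (Multiset n)

nbhd : ∀ {n} → Graph n → VSet n → VSet n
nbhd {n} G S v = any (λ u → S u ∧ adj G u v) (allFin n)

minus : ∀ {n} → VSet n → Multiset n → VSet n
minus S H v = S v ∧ not (any (λ u → ⌊ u ≟ v ⌋) H)

fullSet : ∀ {n} → VSet n
fullSet _ = true

IsEmpty : ∀ {n} → VSet n → Set
IsEmpty S = ∀ v → S v ≡ false

-- the list R(i), R(i+1), ..., R(i+m) starting from R(i) = S with remaining shots H_{i+1..}
rounds : ∀ {n} → Graph n → VSet n → Strategy n → List (VSet n)
rounds G S []       = S ∷ []
rounds G S (h ∷ hs) = S ∷ rounds G (nbhd G (minus S h)) hs

Winning : ∀ {n} → Graph n → Strategy n → Set
Winning G H = Any IsEmpty (rounds G fullSet H)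

width : ∀ {n} → Strategy n → ℕ
width H = foldr _⊔_ 0 (map length H)

-- Hun(G) ≥ k : every winning strategy has width at least k
-- (Hun(G) is the minimum width over winning strategies)
HunAtLeast : ∀ {n} → Graph n → ℕ → Set
HunAtLeast G k = ∀ (H : Strategy _) → Winning G H → k ≤ width H

-- While the hunter fires fewer than δ shots per round, the set of possible
-- positions of the rabbit always contains the whole neighbourhood N(x) of some
-- vertex x.  Initially any x works.  Since |H_i| < δ ≤ deg x, some neighbour y
-- of x escapes the shots; y survives in R(i-1) \ H_i, so R(i) ⊇ N(y).  A set
-- containing N(x) with deg x ≥ δ > 0 is nonempty, so the strategy never wins.
module Submission where

open import Defs
open import Data.Nat using (ℕ; zero; suc; _≤_; _<_; z≤n; s≤s)
open import Data.Nat.Properties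
  using (≤-trans; <-≤-trans; ≤-<-trans; m≤m⊔n; m≤n⊔m; m≤n⇒m≤1+n; <⇒≱; _≤?_; ≰⇒>)
open import Data.Bool using (Bool; true; false; T; if_then_else_)
open import Data.Bool.Properties using (T-∧; T-not-≡)
open import Data.Bool.ListAction using (any)
open import Function.Bundles using (Equivalence)
open import Data.Fin using (Fin; _≟_) renaming (zero to fzero; suc to fsuc)
open import Data.Fin.Properties using (any?)
open import Data.List using (List; []; _∷_; length; tabulate)
open import Data.List.Properties using (map-tabulate)
open import Data.Nat.ListAction using (sum)
open import Data.List.Relation.Unary.Any using (Any; here; there)
import Data.List.Relation.Unary.Any.Properties as Any
open import Data.List.Membership.Propositional using (_∈_; _∉_)
open import Data.Product using (∃; _×_; _,_)
open import Data.Empty using (⊥-elim)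
open import Function using (_∘_)
open import Relation.Nullary using (¬_; yes; no; ¬?; contradiction)
open import Relation.Nullary.Decidable using (⌊_⌋; _×-dec_; T?; decidable-stable)
open import Relation.Binary.PropositionalEquality using (_≡_; refl; cong; subst)
import Relation.Binary.PropositionalEquality as ≡

count : ∀ {n} → (Fin n → Bool) → ℕ
count P = sum (tabulate (λ w → if P w then 1 else 0))

degree≡count : ∀ {n} (G : Graph n) v → degree G v ≡ count (adj G v)
degree≡count G v = cong sum (map-tabulate (λ w → w) (λ w → if adj G v w then 1 else 0))

unsucs : ∀ {n} → List (Fin (suc n)) → List (Fin n)
unsucs []            = []
unsucs (fzero ∷ xs)  = unsucs xs
unsucs (fsuc w ∷ xs) = w ∷ unsucs xs

length-unsucs-≤ : ∀ {n} (xs : List (Fin (suc n))) → length (unsucs xs) ≤ length xs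
length-unsucs-≤ []            = z≤n
length-unsucs-≤ (fzero ∷ xs)  = m≤n⇒m≤1+n (length-unsucs-≤ xs)
length-unsucs-≤ (fsuc w ∷ xs) = s≤s (length-unsucs-≤ xs)

length-unsucs-< : ∀ {n} (xs : List (Fin (suc n))) → fzero ∈ xs → length (unsucs xs) < length xs
length-unsucs-< (fzero ∷ xs)  _           = s≤s (length-unsucs-≤ xs)
length-unsucs-< (fsuc w ∷ xs) (there z∈xs) = s≤s (length-unsucs-< xs z∈xs)

∈-unsucs : ∀ {n} (xs : List (Fin (suc n))) {w} → fsuc w ∈ xs → w ∈ unsucs xs
∈-unsucs (fzero ∷ xs)  (there sw∈xs) = ∈-unsucs xs sw∈xs
∈-unsucs (fsuc u ∷ xs) (here refl)   = here refl
∈-unsucs (fsuc u ∷ xs) (there sw∈xs) = there (∈-unsucs xs sw∈xs)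

count-≤-length : ∀ {n} (P : Fin n → Bool) (xs : List (Fin n)) →
                 (∀ w → T (P w) → w ∈ xs) → count P ≤ length xs
count-≤-length {zero}  P xs P⊆xs = z≤n
count-≤-length {suc n} P xs P⊆xs
  with P fzero in P0 | count-≤-length (P ∘ fsuc) (unsucs xs) (λ w → ∈-unsucs xs ∘ P⊆xs (fsuc w))
... | true  | tail≤ = ≤-trans (s≤s tail≤) (length-unsucs-< xs (P⊆xs fzero (subst T (≡.sym P0) _)))
... | false | tail≤ = ≤-trans tail≤ (length-unsucs-≤ xs)

any-≟-false : ∀ {n} {y : Fin n} (xs : List (Fin n)) → y ∉ xs → any (λ u → ⌊ u ≟ y ⌋) xs ≡ false
any-≟-false []                 _    = refl
any-≟-false {y = y} (u ∷ xs) y∉xs with u ≟ y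
... | yes refl = contradiction (here refl) y∉xs
... | no _     = any-≟-false xs (y∉xs ∘ there)

module _ {n : ℕ} (G : Graph n) where

  open import Data.List.Membership.DecPropositional (_≟_ {n}) using (_∈?_)

  ContainsNbhd : VSet n → Fin n → Set
  ContainsNbhd S x = ∀ y → T (adj G x y) → T (S y)

  degree-≤-length : ∀ x (h : Multiset n) → (∀ y → T (adj G x y) → y ∈ h) → degree G x ≤ length h
  degree-≤-length x h N⊆h =
    subst (_≤ length h) (≡.sym (degree≡count G x)) (count-≤-length (adj G x) h N⊆h)

  unshot-neighbour : ∀ x (h : Multiset n) → length h < degree G x → ∃ λ y → T (adj G x y) × y ∉ h
  unshot-neighbour x h h<deg with any? (λ y → T? (adj G x y) ×-dec ¬? (y ∈? h))
  ... | yes found = found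
  ... | no none   = contradiction (degree-≤-length x h N⊆h) (<⇒≱ h<deg)
    where
    N⊆h : ∀ y → T (adj G x y) → y ∈ h
    N⊆h y xy = decidable-stable (y ∈? h) (λ y∉h → none (y , xy , y∉h))

  ContainsNbhd⇒nonempty : ∀ {S} x → 0 < degree G x → ContainsNbhd S x → ¬ IsEmpty S
  ContainsNbhd⇒nonempty x 0<deg S⊇Nx S≡∅ with unshot-neighbour x [] 0<deg
  ... | y , xy , _ = subst T (S≡∅ y) (S⊇Nx y xy)

  ⊇-nbhd-minus : ∀ {S} {h : Multiset n} {y} → T (S y) → y ∉ h → ContainsNbhd (nbhd G (minus S h)) y
  ⊇-nbhd-minus {S} {h} {y} Sy y∉h z yz =
    Any.any⁺ _ (Any.tabulate⁺ y (Equivalence.from T-∧ (y∈S∖h , yz)))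
    where
    y∈S∖h : T (minus S h y)
    y∈S∖h = Equivalence.from T-∧ (Sy , Equivalence.from T-not-≡ (any-≟-false h y∉h))

  rounds-nonempty : ∀ (H : Strategy n) S x → (∀ v → width H < degree G v) →
                    ContainsNbhd S x → ¬ Any IsEmpty (rounds G S H)
  rounds-nonempty []       S x H<deg S⊇Nx (here S≡∅) =
    ContainsNbhd⇒nonempty x (≤-<-trans z≤n (H<deg x)) S⊇Nx S≡∅
  rounds-nonempty (h ∷ hs) S x H<deg S⊇Nx (here S≡∅) =
    ContainsNbhd⇒nonempty x (≤-<-trans z≤n (H<deg x)) S⊇Nx S≡∅
  rounds-nonempty (h ∷ hs) S x H<deg S⊇Nx (there later)
    with unshot-neighbour x h (≤-<-trans (m≤m⊔n (length h) (width hs)) (H<deg x))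
  ... | y , xy , y∉h =
    rounds-nonempty hs _ y (λ v → ≤-<-trans (m≤n⊔m (length h) (width hs)) (H<deg v))
                    (⊇-nbhd-minus (S⊇Nx y xy) y∉h) later

lemma2p6 : ∀ (n : ℕ) (G : Graph n) (δ : ℕ) → IsMinDegree G δ → HunAtLeast G δ
lemma2p6 n G δ (δ≤deg , x , _) H winning with δ ≤? width H
... | yes δ≤width = δ≤width
... | no  δ≰width =
  ⊥-elim (rounds-nonempty G H fullSet x (λ v → <-≤-trans (≰⇒> δ≰width) (δ≤deg v)) (λ _ _ → _) winning)
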